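{- For every integer $k\geq1$ there is a constant $c$ such that for all $n\geq1$, $K^{(k)}(n)\leq (k+1)\log n+c$.
   Context: Logarithms are base 2. $\#_0,\#_1$ count 0's and 1's; $\ell_k(\sigma)=\#_0(\sigma)+k\,\#_1(\sigma)$. Fix a computable listing $(M_e)$ of prefix-free machines and the universal prefix-free machine $U(0^e1\sigma)=M_e(\sigma)$; $K^{(k)}(\sigma)=\min\{\ell_k(\tau):U(\tau)\downarrow=\sigma\}$. Natural numbers are identified with binary strings via a standard computable bijection. -}

module Defs where

open import Data.Nat using (ℕ; zero; suc; _+_; _*_; _∸_; _^_; _≤_; _<_)
open import Data.Bool using (Bool; true; false)
open import Data.List using (List; []; _∷_; _++_; replicate; reverse)
open import Data.Vec using (Vec; lookup) renaming ([] to []ᵛ; _∷_ to _∷ᵛ_)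
open import Data.Fin using (Fin)
open import Data.Product using (Σ; ∃; _×_; _,_)
open import Relation.Binary.PropositionalEquality using (_≡_)
open import Function.Bundles using (_⇔_)

-- Binary strings; 0 = false, 1 = true.

Str : Set
Str = List Bool

#₀ #₁ : Str → ℕ
#₀ []          = 0
#₀ (false ∷ σ) = suc (#₀ σ)
#₀ (true  ∷ σ) = #₀ σ
#₁ []          = 0
#₁ (false ∷ σ) = #₁ σ
#₁ (true  ∷ σ) = suc (#₁ σ)

ℓ : ℕ → Str → ℕ
ℓ k σ = #₀ σ + k * #₁ σ

-- Standard computable bijection ℕ ≅ Str (length-lexicographic order):
-- σ ↦ (binary value of 1σ) − 1.

bit : Bool → ℕ
bit false = 0
bit true  = 1

val1 : ℕ → Str → ℕ
val1 a []      = a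
val1 a (b ∷ σ) = val1 (2 * a + bit b) σ

enc : Str → ℕ
enc σ = val1 1 σ ∸ 1

-- increment in little-endian form of the digits after the leading 1
incRev : Str → Str
incRev []          = false ∷ []
incRev (false ∷ r) = true ∷ r
incRev (true ∷ r)  = false ∷ incRev r

decRev : ℕ → Str
decRev zero    = []
decRev (suc n) = incRev (decRev n)

str : ℕ → Str
str n = reverse (decRev n)

data PR : ℕ → Set where
  zer  : ∀ {n} → PR n
  sucᶠ : PR 1
  proj : ∀ {n} → Fin n → PR n
  comp : ∀ {n m} → PR m → Vec (PR n) m → PR n
  prec : ∀ {n} → PR n → PR (suc (suc n)) → PR (suc n)
  mu   : ∀ {n} → PR (suc n) → PR n

mutual
  data Eval : ∀ {n} → PR n → Vec ℕ n → ℕ → Set where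
    ezer   : ∀ {n} {xs : Vec ℕ n} → Eval zer xs 0
    esuc   : ∀ {x} → Eval sucᶠ (x ∷ᵛ []ᵛ) (suc x)
    eproj  : ∀ {n} {i : Fin n} {xs} → Eval (proj i) xs (lookup xs i)
    ecomp  : ∀ {n m} {f : PR m} {gs : Vec (PR n) m} {xs ys y} →
             EvalAll gs xs ys → Eval f ys y → Eval (comp f gs) xs y
    eprec0 : ∀ {n} {g : PR n} {h xs y} →
             Eval g xs y → Eval (prec g h) (0 ∷ᵛ xs) y
    eprecS : ∀ {n} {g : PR n} {h x xs r y} →
             Eval (prec g h) (x ∷ᵛ xs) r → Eval h (x ∷ᵛ r ∷ᵛ xs) y →
             Eval (prec g h) (suc x ∷ᵛ xs) y
    emu    : ∀ {n} {f : PR (suc n)} {xs y} →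
             Eval f (y ∷ᵛ xs) 0 →
             (∀ z → z < y → Σ ℕ λ v → Eval f (z ∷ᵛ xs) (suc v)) →
             Eval (mu f) xs y

  data EvalAll : ∀ {n m} → Vec (PR n) m → Vec ℕ n → Vec ℕ m → Set where
    []ₑ  : ∀ {n} {xs : Vec ℕ n} → EvalAll []ᵛ xs []ᵛ
    _∷ₑ_ : ∀ {n m} {g : PR n} {gs : Vec (PR n) m} {xs y ys} →
           Eval g xs y → EvalAll gs xs ys → EvalAll (g ∷ᵛ gs) xs (y ∷ᵛ ys)

-- Partial functions on strings, given by their graphs.

PFun : Set₁
PFun = Str → Str → Set

Functional : PFun → Set
Functional G = ∀ {σ τ τ'} → G σ τ → G σ τ' → τ ≡ τ'

Dom : PFun → Str → Set
Dom G σ = ∃ λ τ → G σ τ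

PrefixFree : PFun → Set
PrefixFree G = ∀ σ ρ → Dom G σ → Dom G (σ ++ ρ) → ρ ≡ []

Computable : PFun → Set
Computable G = Σ (PR 1) λ c →
  ∀ σ τ → G σ τ ⇔ Eval c (enc σ ∷ᵛ []ᵛ) (enc τ)

PrefixFreeMachine : PFun → Set
PrefixFreeMachine G = Functional G × Computable G × PrefixFree G

record Listing (M : ℕ → PFun) : Set₁ where
  field
    machines   : ∀ e → PrefixFreeMachine (M e)
    uniform    : Σ (PR 2) λ c →
                   ∀ e σ τ → M e σ τ ⇔ Eval c (e ∷ᵛ enc σ ∷ᵛ []ᵛ) (enc τ)
    complete   : ∀ G → PrefixFreeMachine G →
                   Σ ℕ λ e → ∀ σ τ → G σ τ ⇔ M e σ τ

U : (ℕ → PFun) → PFun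
U M τ ρ = Σ ℕ λ e → Σ Str λ σ → (τ ≡ replicate e false ++ true ∷ σ) × M e σ ρ

module Submission where

-- Encode a string s by the self-delimiting word  code s = 0^|s| 1 s.
-- The decoder  code s ↦ s  is a prefix-free machine, hence equal to some M_e,
-- and U prints s on  τ = 0^e 1 (code s).  Its cost is
--   ℓ_k τ = e + k + |s| + k + ℓ_k s ≤ (e + 2k) + (k+1)|s|,
-- and for s = str n we have 2^|s| ≤ 2n; so c = e + 3k + 1 works.
--
-- The only real work is showing that the decoder is partial computable.
-- Writing value σ for the number 1σ in binary (so enc σ = value σ - 1), a
-- codeword of a string of length m has value 2^(2m+1) + value s, which lies in
-- the window [2^(2m+1) + 2^m, 2^(2m+1) + 2^(m+1)); these windows are disjoint
-- and increase with m.  The decoder program μ-searches for the window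
-- containing enc σ + 1 and then subtracts the header 2^(2m+1).

open import Defs
open import Data.Nat using (ℕ; zero; suc; pred; _+_; _*_; _∸_; _^_; _≤_; _<_; z≤n; s≤s)
open import Data.Nat.Properties
open import Data.Nat.Tactic.RingSolver using (solve-∀)
open import Data.Bool using (true; false)
open import Data.List using ([]; _∷_; _++_; replicate; reverse; length)
open import Data.List.Properties
  using (∷-injectiveʳ; ++-assoc; unfold-reverse; reverse-involutive; reverse-injective)
open import Data.Vec using (Vec) renaming ([] to []ᵛ; _∷_ to _∷ᵛ_)
open import Data.Fin using () renaming (zero to fz; suc to fs)
open import Data.Product using (Σ; _×_; _,_; proj₁; proj₂)
open import Data.Empty using (⊥-elim)
open import Function.Bundles using (_⇔_; mk⇔; Equivalence)
open import Relation.Binary.Definitions using (tri<; tri≈; tri>)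
open import Relation.Binary.PropositionalEquality

-- 1. Programs: determinism of evaluation, arithmetic programs, μ-search.

mutual
  eval-deterministic : ∀ {n} {p : PR n} {xs y y'} →
                       Eval p xs y → Eval p xs y' → y ≡ y'
  eval-deterministic ezer ezer = refl
  eval-deterministic esuc esuc = refl
  eval-deterministic eproj eproj = refl
  eval-deterministic (ecomp args f) (ecomp args' f')
    with evalAll-deterministic args args'
  ... | refl = eval-deterministic f f'
  eval-deterministic (eprec0 g) (eprec0 g') = eval-deterministic g g'
  eval-deterministic (eprecS r h) (eprecS r' h') with eval-deterministic r r'
  ... | refl = eval-deterministic h h'
  eval-deterministic (emu {y = y} zero-at positive) (emu {y = y'} zero-at' positive')
    with <-cmp y y'
  ... | tri< y<y' _ _ = ⊥-elim (0≢1+n (eval-deterministic zero-at (proj₂ (positive' y y<y'))))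
  ... | tri≈ _ y≡y' _ = y≡y'
  ... | tri> _ _ y'<y = ⊥-elim (0≢1+n (eval-deterministic zero-at' (proj₂ (positive y' y'<y))))

  evalAll-deterministic : ∀ {n m} {ps : Vec (PR n) m} {xs ys ys'} →
                          EvalAll ps xs ys → EvalAll ps xs ys' → ys ≡ ys'
  evalAll-deterministic []ₑ []ₑ = refl
  evalAll-deterministic (e ∷ₑ es) (e' ∷ₑ es') =
    cong₂ _∷ᵛ_ (eval-deterministic e e') (evalAll-deterministic es es')

Computes₁ : PR 1 → (ℕ → ℕ) → Set
Computes₁ p f = ∀ x → Eval p (x ∷ᵛ []ᵛ) (f x)

Computes₂ : PR 2 → (ℕ → ℕ → ℕ) → Set
Computes₂ p f = ∀ x y → Eval p (x ∷ᵛ y ∷ᵛ []ᵛ) (f x y)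

arg₀ arg₁ : PR 2
arg₀ = proj fz
arg₁ = proj (fs fz)

app₁ : PR 1 → PR 2 → PR 2
app₁ f a = comp f (a ∷ᵛ []ᵛ)

app₂ : PR 2 → PR 2 → PR 2 → PR 2
app₂ f a b = comp f (a ∷ᵛ b ∷ᵛ []ᵛ)

arg₀-computes : Computes₂ arg₀ (λ x y → x)
arg₀-computes x y = eproj

arg₁-computes : Computes₂ arg₁ (λ x y → y)
arg₁-computes x y = eproj

suc-computes : Computes₁ sucᶠ suc
suc-computes x = esuc

app₁-computes : ∀ {f a F A} → Computes₁ f F → Computes₂ a A →
                Computes₂ (app₁ f a) (λ x y → F (A x y))
app₁-computes {A = A} f a x y = ecomp (a x y ∷ₑ []ₑ) (f (A x y))

app₂-computes : ∀ {f a b F A B} → Computes₂ f F → Computes₂ a A → Computes₂ b B →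
                Computes₂ (app₂ f a b) (λ x y → F (A x y) (B x y))
app₂-computes {A = A} {B = B} f a b x y =
  ecomp (a x y ∷ₑ (b x y ∷ₑ []ₑ)) (f (A x y) (B x y))

predP : PR 1
predP = prec zer arg₀

pred-computes : Computes₁ predP pred
pred-computes zero    = eprec0 ezer
pred-computes (suc x) = eprecS (pred-computes x) eproj

addP : PR 2
addP = prec (proj fz) (comp sucᶠ (proj (fs fz) ∷ᵛ []ᵛ))

add-computes : Computes₂ addP _+_
add-computes zero    y = eprec0 eproj
add-computes (suc x) y = eprecS (add-computes x y) (ecomp (eproj ∷ₑ []ₑ) esuc)

subtractFromP : PR 2
subtractFromP = prec (proj fz) (comp predP (proj (fs fz) ∷ᵛ []ᵛ))

subtractFrom-computes : Computes₂ subtractFromP (λ x y → y ∸ x)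
subtractFrom-computes zero    y = eprec0 eproj
subtractFrom-computes (suc x) y =
  subst (Eval subtractFromP _) (pred[m∸n]≡m∸[1+n] y x)
    (eprecS (subtractFrom-computes x y) (ecomp (eproj ∷ₑ []ₑ) (pred-computes (y ∸ x))))

monusP : PR 2
monusP = app₂ subtractFromP arg₁ arg₀

monus-computes : Computes₂ monusP _∸_
monus-computes = app₂-computes subtractFrom-computes arg₁-computes arg₀-computes

pow2P : PR 1
pow2P = prec (comp sucᶠ (zer ∷ᵛ []ᵛ)) (app₂ addP arg₁ arg₁)

pow2-computes : Computes₁ pow2P (2 ^_)
pow2-computes zero    = eprec0 (ecomp (ezer ∷ₑ []ₑ) esuc)
pow2-computes (suc x) =
  subst (Eval pow2P _) (cong (2 ^ x +_) (sym (+-identityʳ (2 ^ x))))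
    (eprecS (pow2-computes x)
            (app₂-computes add-computes arg₁-computes arg₁-computes x (2 ^ x)))

mu-intro : ∀ {f F} → Computes₂ f F → ∀ {m x} →
           F m x ≡ 0 → (∀ z → z < m → F z x ≢ 0) → Eval (mu f) (x ∷ᵛ []ᵛ) m
mu-intro {f} {F} f-computes {m} {x} zero-at-m nonzero-below =
  emu (subst (Eval f _) zero-at-m (f-computes m x)) positive
  where
  positive : ∀ z → z < m → Σ ℕ λ v → Eval f (z ∷ᵛ x ∷ᵛ []ᵛ) (suc v)
  positive z z<m with F z x | f-computes z x | nonzero-below z z<m
  ... | zero  | _   | nonzero = ⊥-elim (nonzero refl)
  ... | suc v | run | _       = v , run

mu-elim : ∀ {f F} → Computes₂ f F → ∀ {m x} → Eval (mu f) (x ∷ᵛ []ᵛ) m → F m x ≡ 0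
mu-elim f-computes {m} {x} (emu zero-at-m _) =
  eval-deterministic (f-computes m x) zero-at-m

-- 2. Binary values of strings.

value : Str → ℕ
value = val1 1

val1-++ : ∀ a σ ρ → val1 a (σ ++ ρ) ≡ val1 (val1 a σ) ρ
val1-++ a []      ρ = refl
val1-++ a (b ∷ σ) ρ = val1-++ (2 * a + bit b) σ ρ

val1-+ : ∀ a c σ → val1 (a + c) σ ≡ a * 2 ^ length σ + val1 c σ
val1-+ a c []      = cong (_+ c) (sym (*-identityʳ a))
val1-+ a c (b ∷ σ) = begin
  val1 (2 * (a + c) + bit b) σ         ≡⟨ cong (λ z → val1 z σ) (regroup a c (bit b)) ⟩
  val1 (2 * a + (2 * c + bit b)) σ     ≡⟨ val1-+ (2 * a) (2 * c + bit b) σ ⟩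
  2 * a * P + val1 (2 * c + bit b) σ   ≡⟨ cong (_+ val1 (2 * c + bit b) σ) (shift a P) ⟩
  a * (2 * P) + val1 (2 * c + bit b) σ ∎
  where
  open ≡-Reasoning
  P = 2 ^ length σ
  regroup : ∀ a c d → 2 * (a + c) + d ≡ 2 * a + (2 * c + d)
  regroup = solve-∀
  shift : ∀ a P → 2 * a * P ≡ a * (2 * P)
  shift = solve-∀

value-split : ∀ σ → value σ ≡ 2 ^ length σ + val1 0 σ
value-split σ = trans (val1-+ 1 0 σ) (cong (_+ val1 0 σ) (*-identityˡ (2 ^ length σ)))

digits-< : ∀ σ → val1 0 σ < 2 ^ length σ
digits-< []          = s≤s z≤n
digits-< (false ∷ σ) = ≤-trans (digits-< σ) (m≤m+n _ _)
digits-< (true ∷ σ)  = begin-strict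
  value σ                ≡⟨ value-split σ ⟩
  P + val1 0 σ           <⟨ +-monoʳ-< P (digits-< σ) ⟩
  P + P                  ≡⟨ cong (P +_) (sym (+-identityʳ P)) ⟩
  2 * P                  ∎
  where
  open ≤-Reasoning
  P = 2 ^ length σ

value-bounds : ∀ σ → 2 ^ length σ ≤ value σ × value σ < 2 ^ suc (length σ)
value-bounds σ = subst (2 ^ length σ ≤_) (sym (value-split σ)) (m≤m+n _ _) , digits-< (true ∷ σ)

value-positive : ∀ σ → 1 ≤ value σ
value-positive σ = ≤-trans (m^n>0 2 (length σ)) (proj₁ (value-bounds σ))

suc-enc : ∀ σ → suc (enc σ) ≡ value σ
suc-enc σ = m+[n∸m]≡n (value-positive σ)

bitLength-unique : ∀ {a b v} → 2 ^ a ≤ v × v < 2 ^ suc a → 2 ^ b ≤ v × v < 2 ^ suc b → a ≡ b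
bitLength-unique {a} {b} (lo-a , hi-a) (lo-b , hi-b) with <-cmp a b
... | tri< a<b _ _ = ⊥-elim (<-irrefl refl (<-≤-trans hi-a (≤-trans (^-monoʳ-≤ 2 a<b) lo-b)))
... | tri≈ _ a≡b _ = a≡b
... | tri> _ _ b<a = ⊥-elim (<-irrefl refl (<-≤-trans hi-b (≤-trans (^-monoʳ-≤ 2 b<a) lo-a)))

value-reverse-∷ : ∀ b r → value (reverse (b ∷ r)) ≡ bit b + 2 * value (reverse r)
value-reverse-∷ b r = begin
  value (reverse (b ∷ r))          ≡⟨ cong value (unfold-reverse b r) ⟩
  value (reverse r ++ b ∷ [])      ≡⟨ val1-++ 1 (reverse r) (b ∷ []) ⟩
  2 * value (reverse r) + bit b    ≡⟨ +-comm _ (bit b) ⟩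
  bit b + 2 * value (reverse r)    ∎
  where open ≡-Reasoning

bit-double-injective : ∀ b b' x y → bit b + 2 * x ≡ bit b' + 2 * y → b ≡ b' × x ≡ y
bit-double-injective false false x y eq = refl , *-cancelˡ-≡ x y 2 eq
bit-double-injective true  true  x y eq = refl , *-cancelˡ-≡ x y 2 (suc-injective eq)
bit-double-injective false true  x y eq = ⊥-elim (even≢odd x y eq)
bit-double-injective true  false x y eq = ⊥-elim (even≢odd y x (sym eq))

-- value [] = 1 = bit true + 2 * 0, whereas nonempty strings have positive halves.
value-reverse-∷≢1 : ∀ b r → value (reverse (b ∷ r)) ≢ 1
value-reverse-∷≢1 b r is-one = <-irrefl refl (subst (1 ≤_) half≡0 (value-positive (reverse r)))
  where
  half≡0 : value (reverse r) ≡ 0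
  half≡0 = sym (proj₂ (bit-double-injective true b 0 _ (trans (sym is-one) (value-reverse-∷ b r))))

value-reverse-injective : ∀ r r' → value (reverse r) ≡ value (reverse r') → r ≡ r'
value-reverse-injective []      []        _  = refl
value-reverse-injective []      (b' ∷ r') eq = ⊥-elim (value-reverse-∷≢1 b' r' (sym eq))
value-reverse-injective (b ∷ r) []        eq = ⊥-elim (value-reverse-∷≢1 b r eq)
value-reverse-injective (b ∷ r) (b' ∷ r') eq
  with bit-double-injective b b' _ _
         (trans (sym (value-reverse-∷ b r)) (trans eq (value-reverse-∷ b' r')))
... | refl , halves = cong (b ∷_) (value-reverse-injective r r' halves)

value-injective : ∀ σ σ' → value σ ≡ value σ' → σ ≡ σ'
value-injective σ σ' eq = reverse-injective (value-reverse-injective (reverse σ) (reverse σ')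
  (subst₂ (λ ρ ρ' → value ρ ≡ value ρ') (sym (reverse-involutive σ)) (sym (reverse-involutive σ')) eq))

value-incRev : ∀ r → value (reverse (incRev r)) ≡ suc (value (reverse r))
value-incRev []          = refl
value-incRev (false ∷ r) = begin
  value (reverse (true ∷ r))          ≡⟨ value-reverse-∷ true r ⟩
  suc (2 * value (reverse r))         ≡⟨ cong suc (sym (value-reverse-∷ false r)) ⟩
  suc (value (reverse (false ∷ r)))   ∎
  where open ≡-Reasoning
value-incRev (true ∷ r)  = begin
  value (reverse (false ∷ incRev r))  ≡⟨ value-reverse-∷ false (incRev r) ⟩
  2 * value (reverse (incRev r))      ≡⟨ cong (2 *_) (value-incRev r) ⟩
  2 * suc (value (reverse r))         ≡⟨ *-suc 2 _ ⟩
  2 + 2 * value (reverse r)           ≡⟨ cong suc (sym (value-reverse-∷ true r)) ⟩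
  suc (value (reverse (true ∷ r)))    ∎
  where open ≡-Reasoning

value-str : ∀ n → value (str n) ≡ suc n
value-str zero    = refl
value-str (suc n) = trans (value-incRev (decRev n)) (cong suc (value-str n))

length-str : ∀ n → 1 ≤ n → 2 ^ length (str n) ≤ 2 * n
length-str n 1≤n = begin
  2 ^ length (str n)   ≤⟨ proj₁ (value-bounds (str n)) ⟩
  value (str n)        ≡⟨ value-str n ⟩
  1 + n                ≤⟨ +-monoˡ-≤ n 1≤n ⟩
  n + n                ≡⟨ cong (n +_) (sym (+-identityʳ n)) ⟩
  2 * n                ∎
  where open ≤-Reasoning

-- 3. The self-delimiting code and its value windows.

-- 0^m 1 σ : the number m in unary, followed by σ.  The universal machine
-- reads its machine index in this form, and the code uses it for |σ|.
unary : ℕ → Str → Str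
unary m σ = replicate m false ++ true ∷ σ

unary-injective : ∀ m m' σ σ' → unary m σ ≡ unary m' σ' → m ≡ m' × σ ≡ σ'
unary-injective zero    zero     σ σ' refl = refl , refl
unary-injective (suc m) (suc m') σ σ' eq
  with unary-injective m m' σ σ' (∷-injectiveʳ eq)
... | refl , σ≡σ' = refl , σ≡σ'

val1-zeros : ∀ a m → val1 a (replicate m false) ≡ a * 2 ^ m
val1-zeros a zero    = sym (*-identityʳ a)
val1-zeros a (suc m) = trans (val1-zeros (2 * a + 0) m) (shift a (2 ^ m))
  where
  shift : ∀ a P → (2 * a + 0) * P ≡ a * (2 * P)
  shift = solve-∀

value-unary : ∀ m σ → value (unary m σ) ≡ 2 ^ suc m * 2 ^ length σ + value σ
value-unary m σ = begin
  value (replicate m false ++ true ∷ σ)         ≡⟨ val1-++ 1 (replicate m false) (true ∷ σ) ⟩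
  val1 (2 * value (replicate m false) + 1) σ    ≡⟨ cong (λ z → val1 (2 * z + 1) σ) zeros ⟩
  val1 (2 * 2 ^ m + 1) σ                        ≡⟨ val1-+ (2 * 2 ^ m) 1 σ ⟩
  2 ^ suc m * 2 ^ length σ + value σ            ∎
  where
  open ≡-Reasoning
  zeros : value (replicate m false) ≡ 2 ^ m
  zeros = trans (val1-zeros 1 m) (*-identityˡ (2 ^ m))

code : Str → Str
code s = unary (length s) s

-- The leading part 1 0^m 1 of a codeword with |s| = m is worth header m.
header : ℕ → ℕ
header m = 2 ^ suc (m + m)

value-code : ∀ s → value (code s) ≡ header (length s) + value s
value-code s = trans (value-unary m s) (cong (_+ value s) (sym (^-distribˡ-+-* 2 (suc m) m)))
  where m = length s

low high : ℕ → ℕ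
low  m = header m + 2 ^ m
high m = header m + 2 ^ suc m

InWindow : ℕ → ℕ → Set
InWindow m v = low m ≤ v × v < high m

code-in-window : ∀ s → InWindow (length s) (value (code s))
code-in-window s = subst (InWindow m) (sym (value-code s))
  (+-monoʳ-≤ (header m) (proj₁ (value-bounds s)) , +-monoʳ-< (header m) (proj₂ (value-bounds s)))
  where m = length s

window-digits : ∀ m v → InWindow m (header m + v) → 2 ^ m ≤ v × v < 2 ^ suc m
window-digits m v (lo , hi) = +-cancelˡ-≤ (header m) _ _ lo , +-cancelˡ-< (header m) _ _ hi

high≤header : ∀ {z m} → z < m → high z ≤ header m
high≤header {z} {m} z<m = begin
  header z + 2 ^ suc z                 ≤⟨ +-monoʳ-≤ (header z) (^-monoʳ-≤ 2 (s≤s (m≤m+n z z))) ⟩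
  header z + header z                  ≡⟨ cong (header z +_) (sym (+-identityʳ (header z))) ⟩
  2 ^ suc (suc (z + z))                ≤⟨ ^-monoʳ-≤ 2 (s≤s (+-mono-≤ z<m (<⇒≤ z<m))) ⟩
  header m                             ∎
  where open ≤-Reasoning

-- 4. The decoder is a prefix-free machine.

-- outside m N vanishes exactly when N + 1 lies in window m.
outside : ℕ → ℕ → ℕ
outside m N = (low m ∸ suc N) + (suc (suc N) ∸ high m)

inside⇒outside≡0 : ∀ m N → InWindow m (suc N) → outside m N ≡ 0
inside⇒outside≡0 m N (lo , hi) = cong₂ _+_ (m≤n⇒m∸n≡0 lo) (m≤n⇒m∸n≡0 hi)

outside≡0⇒inside : ∀ m N → outside m N ≡ 0 → InWindow m (suc N)
outside≡0⇒inside m N eq =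
  m∸n≡0⇒m≤n (m+n≡0⇒m≡0 _ eq) , m∸n≡0⇒m≤n (m+n≡0⇒n≡0 (low m ∸ suc N) eq)

headerP lowP highP outsideP stripP : PR 2
headerP  = app₁ pow2P (app₁ sucᶠ (app₂ addP arg₀ arg₀))
lowP     = app₂ addP headerP (app₁ pow2P arg₀)
highP    = app₂ addP headerP (app₁ pow2P (app₁ sucᶠ arg₀))
outsideP = app₂ addP (app₂ monusP lowP (app₁ sucᶠ arg₁))
                     (app₂ monusP (app₁ sucᶠ (app₁ sucᶠ arg₁)) highP)
stripP   = app₂ monusP arg₁ headerP

header-computes : Computes₂ headerP (λ m N → header m)
header-computes = app₁-computes pow2-computes
  (app₁-computes suc-computes (app₂-computes add-computes arg₀-computes arg₀-computes))

outside-computes : Computes₂ outsideP outside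
outside-computes = app₂-computes add-computes
  (app₂-computes monus-computes low-computes (app₁-computes suc-computes arg₁-computes))
  (app₂-computes monus-computes
    (app₁-computes suc-computes (app₁-computes suc-computes arg₁-computes)) high-computes)
  where
  low-computes : Computes₂ lowP (λ m N → low m)
  low-computes = app₂-computes add-computes header-computes
    (app₁-computes pow2-computes arg₀-computes)
  high-computes : Computes₂ highP (λ m N → high m)
  high-computes = app₂-computes add-computes header-computes
    (app₁-computes pow2-computes (app₁-computes suc-computes arg₀-computes))

strip-computes : Computes₂ stripP (λ m N → N ∸ header m)
strip-computes = app₂-computes monus-computes arg₁-computes header-computes

-- The decoder finds the window m containing N + 1 and strips its header.
decoderP : PR 1
decoderP = comp stripP (mu outsideP ∷ᵛ proj fz ∷ᵛ []ᵛ)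

decoder-intro : ∀ m N → outside m N ≡ 0 → (∀ z → z < m → outside z N ≢ 0) →
                Eval decoderP (N ∷ᵛ []ᵛ) (N ∸ header m)
decoder-intro m N here nowhere-before =
  ecomp (mu-intro outside-computes here nowhere-before ∷ₑ (eproj ∷ₑ []ₑ)) (strip-computes m N)

decoder-elim : ∀ {N y} → Eval decoderP (N ∷ᵛ []ᵛ) y →
               Σ ℕ λ m → outside m N ≡ 0 × y ≡ N ∸ header m
decoder-elim {N} (ecomp {ys = m ∷ᵛ _} (search ∷ₑ (eproj ∷ₑ []ₑ)) strip) =
  m , mu-elim outside-computes search , eval-deterministic strip (strip-computes m N)

Decoder : PFun
Decoder σ τ = σ ≡ code τ

decoder-functional : Functional Decoder
decoder-functional refl eq = proj₂ (unary-injective _ _ _ _ eq)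

++-same-length : ∀ (τ ρ τ' : Str) → τ ++ ρ ≡ τ' → length τ ≡ length τ' → ρ ≡ []
++-same-length []      []      _        _  _   = refl
++-same-length []      (_ ∷ _) _        refl ()
++-same-length (_ ∷ τ) ρ       (_ ∷ τ') eq len =
  ++-same-length τ ρ τ' (∷-injectiveʳ eq) (suc-injective len)

decoder-prefixFree : PrefixFree Decoder
decoder-prefixFree _ ρ (τ , refl) (τ' , extended)
  with unary-injective (length τ) (length τ') (τ ++ ρ) τ'
         (trans (sym (++-assoc (replicate (length τ) false) (true ∷ τ) ρ)) extended)
... | same-length , τρ≡τ' = ++-same-length τ ρ τ' τρ≡τ' same-length

strip-code : ∀ τ → enc (code τ) ∸ header (length τ) ≡ enc τ
strip-code τ = begin
  value (code τ) ∸ 1 ∸ H      ≡⟨ cong (λ v → v ∸ 1 ∸ H) (value-code τ) ⟩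
  H + value τ ∸ 1 ∸ H         ≡⟨ ∸-+-assoc (H + value τ) 1 H ⟩
  H + value τ ∸ (1 + H)       ≡⟨ cong (H + value τ ∸_) (+-comm 1 H) ⟩
  H + value τ ∸ (H + 1)       ≡⟨ [m+n]∸[m+o]≡n∸o H (value τ) 1 ⟩
  value τ ∸ 1                 ∎
  where
  open ≡-Reasoning
  H = header (length τ)

decoder-sound : ∀ τ → Eval decoderP (enc (code τ) ∷ᵛ []ᵛ) (enc τ)
decoder-sound τ = subst (Eval decoderP _) (strip-code τ)
  (decoder-intro m N (inside⇒outside≡0 m N window) nowhere-before)
  where
  m = length τ
  N = enc (code τ)
  window : InWindow m (suc N)
  window = subst (InWindow m) (sym (suc-enc (code τ))) (code-in-window τ)
  nowhere-before : ∀ z → z < m → outside z N ≢ 0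
  nowhere-before z z<m there = <-irrefl refl
    (<-≤-trans (proj₂ (outside≡0⇒inside z N there))
      (≤-trans (high≤header z<m) (≤-trans (m≤m+n _ _) (proj₁ window))))

decoder-complete : ∀ σ τ → Eval decoderP (enc σ ∷ᵛ []ᵛ) (enc τ) → σ ≡ code τ
decoder-complete σ τ run with decoder-elim run
... | m , here , enc-τ = sym (value-injective (code τ) σ (begin
  value (code τ)               ≡⟨ value-code τ ⟩
  header (length τ) + value τ  ≡⟨ cong (λ l → header l + value τ) length-τ ⟩
  H + value τ                  ≡⟨ value-τ ⟩
  suc N                        ≡⟨ suc-enc σ ⟩
  value σ                      ∎))
  where
  open ≡-Reasoning
  N = enc σ
  H = header m
  window : InWindow m (suc N)
  window = outside≡0⇒inside m N here
  H≤N : H ≤ N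
  H≤N = ≤-pred (<-≤-trans (m<m+n H (m^n>0 2 m)) (proj₁ window))
  value-τ : H + value τ ≡ suc N
  value-τ = begin
    H + value τ        ≡⟨ cong (H +_) (sym (suc-enc τ)) ⟩
    H + suc (enc τ)    ≡⟨ cong (λ y → H + suc y) enc-τ ⟩
    H + suc (N ∸ H)    ≡⟨ +-suc H (N ∸ H) ⟩
    suc (H + (N ∸ H))  ≡⟨ cong suc (m+[n∸m]≡n H≤N) ⟩
    suc N              ∎
  length-τ : length τ ≡ m
  length-τ = bitLength-unique (value-bounds τ)
    (window-digits m (value τ) (subst (InWindow m) (sym value-τ) window))

decoder-machine : PrefixFreeMachine Decoder
decoder-machine = decoder-functional
                , (decoderP , λ σ τ → mk⇔ (λ { refl → decoder-sound τ }) (decoder-complete σ τ))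
                , decoder-prefixFree

-- 5. The cost of the program 0^e 1 (code s).

ℓ-unary : ∀ k m σ → ℓ k (unary m σ) ≡ m + k + ℓ k σ
ℓ-unary k zero    σ = trans (cong (#₀ σ +_) (*-suc k (#₁ σ))) (swap (#₀ σ) k (k * #₁ σ))
  where
  swap : ∀ a b c → a + (b + c) ≡ b + (a + c)
  swap = solve-∀
ℓ-unary k (suc m) σ = cong suc (ℓ-unary k m σ)

ℓ-≤ : ∀ k → 1 ≤ k → ∀ σ → ℓ k σ ≤ k * length σ
ℓ-≤ k 1≤k []          = ≤-refl
ℓ-≤ k 1≤k (false ∷ σ) = subst (suc (ℓ k σ) ≤_) (sym (*-suc k (length σ)))
  (+-mono-≤ 1≤k (ℓ-≤ k 1≤k σ))
ℓ-≤ k 1≤k (true ∷ σ)  = subst₂ _≤_ (sym (ℓ-unary k 0 σ)) (sym (*-suc k (length σ)))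
  (+-monoʳ-≤ k (ℓ-≤ k 1≤k σ))

ℓ-program : ∀ k → 1 ≤ k → ∀ e s → ℓ k (unary e (code s)) ≤ e + k + k + length s * (k + 1)
ℓ-program k 1≤k e s = begin
  ℓ k (unary e (code s))       ≡⟨ ℓ-unary k e (code s) ⟩
  e + k + ℓ k (unary m s)      ≡⟨ cong (e + k +_) (ℓ-unary k m s) ⟩
  e + k + (m + k + ℓ k s)      ≤⟨ +-monoʳ-≤ (e + k) (+-monoʳ-≤ (m + k) (ℓ-≤ k 1≤k s)) ⟩
  e + k + (m + k + k * m)      ≡⟨ regroup e k m ⟩
  e + k + k + m * (k + 1)      ∎
  where
  open ≤-Reasoning
  m = length s
  regroup : ∀ e k m → e + k + (m + k + k * m) ≡ e + k + k + m * (k + 1)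
  regroup = solve-∀

*-^-distrib : ∀ x y j → (x * y) ^ j ≡ x ^ j * y ^ j
*-^-distrib x y zero    = refl
*-^-distrib x y (suc j) = trans (cong (x * y *_) (*-^-distrib x y j)) (interchange x y (x ^ j) (y ^ j))
  where
  interchange : ∀ a b c d → a * b * (c * d) ≡ a * c * (b * d)
  interchange = solve-∀

pow-scale : ∀ a j m n → 2 ^ m ≤ 2 * n → 2 ^ (a + m * j) ≤ 2 ^ (a + j) * n ^ j
pow-scale a j m n 2^m≤2n = begin
  2 ^ (a + m * j)          ≡⟨ ^-distribˡ-+-* 2 a (m * j) ⟩
  2 ^ a * 2 ^ (m * j)      ≡⟨ cong (2 ^ a *_) (sym (^-*-assoc 2 m j)) ⟩
  2 ^ a * (2 ^ m) ^ j      ≤⟨ *-monoʳ-≤ (2 ^ a) (^-monoˡ-≤ j 2^m≤2n) ⟩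
  2 ^ a * (2 * n) ^ j      ≡⟨ cong (2 ^ a *_) (*-^-distrib 2 n j) ⟩
  2 ^ a * (2 ^ j * n ^ j)  ≡⟨ sym (*-assoc (2 ^ a) (2 ^ j) (n ^ j)) ⟩
  2 ^ a * 2 ^ j * n ^ j    ≡⟨ cong (_* n ^ j) (sym (^-distribˡ-+-* 2 a j)) ⟩
  2 ^ (a + j) * n ^ j      ∎
  where open ≤-Reasoning

mainTheorem17 : (M : ℕ → PFun) → Listing M →
    (k : ℕ) → 1 ≤ k →
    Σ ℕ λ c → (n : ℕ) → 1 ≤ n →
      Σ Str λ τ → U M τ (str n) × 2 ^ ℓ k τ ≤ 2 ^ c * n ^ (k + 1)
mainTheorem17 M listing k 1≤k = e + k + k + (k + 1) , λ n 1≤n →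
    unary e (code (str n))
  , (e , code (str n) , refl , Equivalence.to (decoder-is-M-e (code (str n)) (str n)) refl)
  , ≤-trans (^-monoʳ-≤ 2 (ℓ-program k 1≤k e (str n)))
            (pow-scale (e + k + k) (k + 1) (length (str n)) n (length-str n 1≤n))
  where
  decoder-index : Σ ℕ λ e → ∀ σ τ → Decoder σ τ ⇔ M e σ τ
  decoder-index = Listing.complete listing Decoder decoder-machine
  e : ℕ
  e = proj₁ decoder-index
  decoder-is-M-e : ∀ σ τ → Decoder σ τ ⇔ M e σ τ
  decoder-is-M-e = proj₂ decoder-index
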